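{- Let $C$ be a finite set, $R\subseteq C$ with $|R|\ge 2$, and let $B_1,\dots,B_l\subseteq C$ be a sequence such that (1) $B_l=C$, and (2) for each $i$ with $1\le i\le l$, either $B_i=\emptyset$, or $B_i=\{c\}$ for some $c\in C$, or $B_i=B_j\cup B_k$ for some $j<k<i$. Then for each $a$ with $\frac{1}{|R|}<a\le\frac12$ there is $j<l$ such that $a|R|\le |B_j\cap R|<2a|R|$. -}

module Defs where

open import Data.Nat using (ℕ; zero; suc)
open import Data.Integer using (+_)
open import Data.Rational using (ℚ; _/_; 0ℚ)

toℚ : ℕ → ℚ
toℚ k = + k / 1

-- 1/k as a rational (value at k = 0 is irrelevant: only used with k ≥ 2)
recip : ℕ → ℚ
recip zero = 0ℚ
recip (suc k) = + 1 / suc k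

module Submission where

-- Write  w i = |B_i ∩ R|  and  x = a·|R|.  Because 1/|R| < a ≤ 1/2
-- we have  1 < x  and  x + x ≤ |R| = w l.  Call a term *light* if its weight is
-- below x.  Every term is either an atom (∅ or a singleton), hence of weight at
-- most 1 and light, or the union of two earlier terms, hence of weight at most
-- the sum of theirs.  By strong induction, each term is light unless some
-- earlier term already lies in the window [x, 2x): a union of two light terms
-- weighs less than 2x, so it is either light or itself in the window.  The last
-- term is too heavy to be light and too heavy to be in the window, so the window
-- is hit strictly before l.

open import Defs
open import Data.Nat as ℕ using (ℕ; suc; _+_; _≤_; _<_; z≤n; s≤s)
import Data.Nat.Properties as ℕP
open import Data.Nat.Induction using (<-rec)
open import Data.Nat.Coprimality using (Coprime; 1-coprimeTo)
import Data.Nat.Coprimality as Coprimality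
open import Data.Integer as ℤ using (+_)
import Data.Integer.Properties as ℤP
open import Data.Rational as ℚ using (ℚ; mkℚ; 0ℚ; 1ℚ; ½; _*_; *≤*)
  renaming (_≤_ to _≤ℚ_; _<_ to _<ℚ_)
import Data.Rational.Properties as ℚP
open import Data.Fin using (Fin)
open import Data.Fin.Subset using (Subset; ⊤; ⊥; ⁅_⁆; _∪_; _∩_; ∣_∣; inside; outside)
open import Data.Fin.Subset.Properties using (∩-distribʳ-∪; ∩-identityˡ; ∣p∩q∣≤∣p∣; ∣⊥∣≡0; ∣⁅x⁆∣≡1)
open import Data.Product using (Σ; _×_; _,_)
open import Data.Sum using (_⊎_; inj₁; inj₂)
open import Data.Vec using (_∷_; [])
open import Data.Empty using (⊥-elim)
open import Relation.Nullary using (yes; no)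
open import Relation.Binary.PropositionalEquality

data Decomposed (w : ℕ → ℚ) (x : ℚ) (i : ℕ) : Set where
  light : w i <ℚ x → Decomposed w x i
  merge : ∀ {j k} → 1 ≤ j → 1 ≤ k → j < i → k < i →
          w i ≤ℚ w j ℚ.+ w k → Decomposed w x i

Crossing : (w : ℕ → ℚ) (x : ℚ) (l : ℕ) → Set
Crossing w x l = Σ ℕ λ j → 1 ≤ j × j < l × x ≤ℚ w j × w j <ℚ x ℚ.+ x

crossing : (w : ℕ → ℚ) (x : ℚ) (l : ℕ) → 0ℚ ≤ℚ x → 1 ≤ l →
           (∀ i → 1 ≤ i → i ≤ l → Decomposed w x i) →
           x ℚ.+ x ≤ℚ w l → Crossing w x l
crossing w x l 0≤x 1≤l decomposed 2x≤wl =
  conclude (<-rec LightOrCrossing step l 1≤l ℕP.≤-refl)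
  where
  LightOrCrossing : ℕ → Set
  LightOrCrossing i = 1 ≤ i → i ≤ l → w i <ℚ x ⊎ Crossing w x l

  -- A term below 2x is light or in the window; it cannot be the last term,
  -- which weighs at least 2x.
  classify : ∀ i → 1 ≤ i → i ≤ l → w i <ℚ x ℚ.+ x → w i <ℚ x ⊎ Crossing w x l
  classify i 1≤i i≤l wi<2x with x ℚP.≤? w i
  ... | no  x≰wi = inj₁ (ℚP.≰⇒> x≰wi)
  ... | yes x≤wi = inj₂ (i , 1≤i , ℕP.≤∧≢⇒< i≤l i≢l , x≤wi , wi<2x)
    where
    i≢l : i ≢ l
    i≢l refl = ℚP.<-irrefl refl (ℚP.<-≤-trans wi<2x 2x≤wl)

  -- A merge of two light terms weighs less than 2x and is classified.
  step : ∀ i → (∀ {j} → j < i → LightOrCrossing j) → LightOrCrossing i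
  step i ih 1≤i i≤l with decomposed i 1≤i i≤l
  ... | light wi<x = inj₁ wi<x
  ... | merge {j} {k} 1≤j 1≤k j<i k<i wi≤wj+wk
      with ih j<i 1≤j (ℕP.<⇒≤ (ℕP.<-≤-trans j<i i≤l))
         | ih k<i 1≤k (ℕP.<⇒≤ (ℕP.<-≤-trans k<i i≤l))
  ... | inj₂ found | _          = inj₂ found
  ... | inj₁ _     | inj₂ found = inj₂ found
  ... | inj₁ wj<x  | inj₁ wk<x  =
        classify i 1≤i i≤l (ℚP.≤-<-trans wi≤wj+wk (ℚP.+-mono-< wj<x wk<x))

  conclude : w l <ℚ x ⊎ Crossing w x l → Crossing w x l
  conclude (inj₂ found) = found
  conclude (inj₁ wl<x)  =
    ⊥-elim (ℚP.<-irrefl refl (ℚP.<-≤-trans wl<x (ℚP.≤-trans x≤2x 2x≤wl)))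
    where
    x≤2x : x ≤ℚ x ℚ.+ x
    x≤2x = subst (_≤ℚ x ℚ.+ x) (ℚP.+-identityʳ x) (ℚP.+-monoʳ-≤ x 0≤x)

-- The cast toℚ k = k / 1 is the fraction k/1 in lowest terms; this is what
-- makes it accessible to the order and arithmetic of ℚ.
coprime-to-1 : ∀ k → Coprime k 1
coprime-to-1 k = Coprimality.sym (1-coprimeTo k)

toℚ≡k/1 : ∀ k → toℚ k ≡ mkℚ (+ k) 0 (coprime-to-1 k)
toℚ≡k/1 k = ℚP.normalize-coprime (coprime-to-1 k)

toℚ-mono-≤ : ∀ {m n} → m ≤ n → toℚ m ≤ℚ toℚ n
toℚ-mono-≤ {m} {n} m≤n rewrite toℚ≡k/1 m | toℚ≡k/1 n =
  *≤* (subst₂ ℤ._≤_ (sym (ℤP.*-identityʳ (+ m))) (sym (ℤP.*-identityʳ (+ n))) (ℤ.+≤+ m≤n))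

toℚ-+ : ∀ m n → toℚ (m + n) ≡ toℚ m ℚ.+ toℚ n
toℚ-+ m n rewrite toℚ≡k/1 m | toℚ≡k/1 n =
  cong (ℚ._/ 1) (sym (cong₂ ℤ._+_ (ℤP.*-identityʳ (+ m)) (ℤP.*-identityʳ (+ n))))

recip-inverse : ∀ k → 1 ≤ k → recip k * toℚ k ≡ 1ℚ
recip-inverse (suc k) _
  rewrite toℚ≡k/1 (suc k) | ℚP.normalize-coprime {1} {k} (1-coprimeTo (suc k)) =
  ℚP.*-inverseˡ (mkℚ (+ suc k) 0 (coprime-to-1 (suc k)))

∣p∪q∣≤∣p∣+∣q∣ : ∀ {n} (p q : Subset n) → ∣ p ∪ q ∣ ≤ ∣ p ∣ + ∣ q ∣
∣p∪q∣≤∣p∣+∣q∣ []            []            = z≤n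
∣p∪q∣≤∣p∣+∣q∣ (outside ∷ p) (outside ∷ q) = ∣p∪q∣≤∣p∣+∣q∣ p q
∣p∪q∣≤∣p∣+∣q∣ (outside ∷ p) (inside  ∷ q) =
  subst (∣ p ∪ q ∣ ℕ.<_) (sym (ℕP.+-suc ∣ p ∣ ∣ q ∣)) (s≤s (∣p∪q∣≤∣p∣+∣q∣ p q))
∣p∪q∣≤∣p∣+∣q∣ (inside  ∷ p) (outside ∷ q) = s≤s (∣p∪q∣≤∣p∣+∣q∣ p q)
∣p∪q∣≤∣p∣+∣q∣ (inside  ∷ p) (inside  ∷ q) =
  s≤s (ℕP.≤-trans (∣p∪q∣≤∣p∣+∣q∣ p q) (ℕP.+-monoʳ-≤ ∣ p ∣ (ℕP.n≤1+n ∣ q ∣)))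

∣⊥∩r∣≤1 : ∀ {n} (r : Subset n) → ∣ ⊥ ∩ r ∣ ≤ 1
∣⊥∩r∣≤1 {n} r = ℕP.≤-trans (∣p∩q∣≤∣p∣ ⊥ r) (subst (_≤ 1) (sym (∣⊥∣≡0 n)) z≤n)

∣⁅c⁆∩r∣≤1 : ∀ {n} (c : Fin n) (r : Subset n) → ∣ ⁅ c ⁆ ∩ r ∣ ≤ 1
∣⁅c⁆∩r∣≤1 c r = ℕP.≤-trans (∣p∩q∣≤∣p∣ ⁅ c ⁆ r) (ℕP.≤-reflexive (∣⁅x⁆∣≡1 c))

∣[p∪q]∩r∣≤ : ∀ {n} (p q r : Subset n) → ∣ (p ∪ q) ∩ r ∣ ≤ ∣ p ∩ r ∣ + ∣ q ∩ r ∣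
∣[p∪q]∩r∣≤ p q r =
  subst (_≤ ∣ p ∩ r ∣ + ∣ q ∩ r ∣) (cong ∣_∣ (sym (∩-distribʳ-∪ r p q))) (∣p∪q∣≤∣p∣+∣q∣ (p ∩ r) (q ∩ r))

BuiltFromAtoms : ∀ {n} → (ℕ → Subset n) → ℕ → Set
BuiltFromAtoms {n} B l = ∀ i → 1 ≤ i → i ≤ l →
  (B i ≡ ⊥)
  ⊎ (Σ (Fin n) λ c → B i ≡ ⁅ c ⁆)
  ⊎ (Σ ℕ λ j → Σ ℕ λ k → 1 ≤ j × j < k × k < i × B i ≡ B j ∪ B k)

traced-decomposed : ∀ {n} (R : Subset n) (B : ℕ → Subset n) (l : ℕ) →
  BuiltFromAtoms B l → (x : ℚ) → 1ℚ <ℚ x →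
  ∀ i → 1 ≤ i → i ≤ l → Decomposed (λ i → toℚ ∣ B i ∩ R ∣) x i
traced-decomposed R B l built x 1<x i 1≤i i≤l with built i 1≤i i≤l
... | inj₁ Bi≡⊥ =
  light (ℚP.≤-<-trans (toℚ-mono-≤ (subst (λ s → ∣ s ∩ R ∣ ≤ 1) (sym Bi≡⊥) (∣⊥∩r∣≤1 R))) 1<x)
... | inj₂ (inj₁ (c , Bi≡⁅c⁆)) =
  light (ℚP.≤-<-trans (toℚ-mono-≤ (subst (λ s → ∣ s ∩ R ∣ ≤ 1) (sym Bi≡⁅c⁆) (∣⁅c⁆∩r∣≤1 c R))) 1<x)
... | inj₂ (inj₂ (j , k , 1≤j , j<k , k<i , Bi≡Bj∪Bk)) =
  merge 1≤j (ℕP.≤-trans 1≤j (ℕP.<⇒≤ j<k)) (ℕP.<-trans j<k k<i) k<i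
        (subst (toℚ ∣ B i ∩ R ∣ ≤ℚ_) (toℚ-+ ∣ B j ∩ R ∣ ∣ B k ∩ R ∣) (toℚ-mono-≤ sizes))
  where
  sizes : ∣ B i ∩ R ∣ ≤ ∣ B j ∩ R ∣ + ∣ B k ∩ R ∣
  sizes = subst (λ s → ∣ s ∩ R ∣ ≤ ∣ B j ∩ R ∣ + ∣ B k ∩ R ∣) (sym Bi≡Bj∪Bk) (∣[p∪q]∩r∣≤ (B j) (B k) R)

scaled-above-one : ∀ r (a : ℚ) → 1 ≤ r → recip r <ℚ a → 1ℚ <ℚ a * toℚ r
scaled-above-one r a 1≤r r⁻¹<a =
  subst (_<ℚ a * toℚ r) (recip-inverse r 1≤r) (ℚP.*-monoˡ-<-pos (toℚ r) r⁻¹<a)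
  where
  instance
    r-positive : ℚ.Positive (toℚ r)
    r-positive = ℚ.positive (ℚP.<-≤-trans (ℚP.positive⁻¹ 1ℚ) (toℚ-mono-≤ {1} {r} 1≤r))

scaled-twice-≤ : ∀ r (a : ℚ) → a ≤ℚ ½ → a * toℚ r ℚ.+ a * toℚ r ≤ℚ toℚ r
scaled-twice-≤ r a a≤½ = begin
  a * toℚ r ℚ.+ a * toℚ r  ≤⟨ ℚP.+-mono-≤ a·r≤½·r a·r≤½·r ⟩
  ½ * toℚ r ℚ.+ ½ * toℚ r  ≡⟨ ℚP.*-distribʳ-+ (toℚ r) ½ ½ ⟨
  1ℚ * toℚ r               ≡⟨ ℚP.*-identityˡ (toℚ r) ⟩
  toℚ r                    ∎
  where
  open ℚP.≤-Reasoning
  instance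
    r-nonNegative : ℚ.NonNegative (toℚ r)
    r-nonNegative = ℚ.nonNegative (toℚ-mono-≤ {0} {r} z≤n)
  a·r≤½·r : a * toℚ r ≤ℚ ½ * toℚ r
  a·r≤½·r = ℚP.*-monoʳ-≤-nonNeg (toℚ r) a≤½

two-*-≡-double : ∀ a b → toℚ 2 * a * b ≡ a * b ℚ.+ a * b
two-*-≡-double a b = begin
  (1ℚ ℚ.+ 1ℚ) * a * b          ≡⟨ cong (_* b) (ℚP.*-distribʳ-+ a 1ℚ 1ℚ) ⟩
  (1ℚ * a ℚ.+ 1ℚ * a) * b      ≡⟨ cong (λ c → (c ℚ.+ c) * b) (ℚP.*-identityˡ a) ⟩
  (a ℚ.+ a) * b                ≡⟨ ℚP.*-distribʳ-+ b a a ⟩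
  a * b ℚ.+ a * b              ∎
  where open ≡-Reasoning

lemma2 : (n : ℕ) (R : Subset n) → 2 ≤ ∣ R ∣ →
         (l : ℕ) (B : ℕ → Subset n) → 1 ≤ l →
         B l ≡ ⊤ →
         (∀ i → 1 ≤ i → i ≤ l →
            (B i ≡ ⊥)
            ⊎ (Σ (Fin n) λ c → B i ≡ ⁅ c ⁆)
            ⊎ (Σ ℕ λ j → Σ ℕ λ k → 1 ≤ j × j < k × k < i × B i ≡ B j ∪ B k)) →
         (a : ℚ) → recip ∣ R ∣ <ℚ a → a ≤ℚ ½ →
         Σ ℕ λ j → 1 ≤ j × j < l
           × a * toℚ ∣ R ∣ ≤ℚ toℚ ∣ B j ∩ R ∣
           × toℚ ∣ B j ∩ R ∣ <ℚ toℚ 2 * a * toℚ ∣ R ∣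
lemma2 _ R 2≤r l B 1≤l Bl≡⊤ built a r⁻¹<a a≤½
  rewrite two-*-≡-double a (toℚ ∣ R ∣) =
  crossing w x l (ℚP.<⇒≤ (ℚP.<-trans (ℚP.positive⁻¹ 1ℚ) 1<x)) 1≤l
           (traced-decomposed R B l built x 1<x) 2x≤wl
  where
  w : ℕ → ℚ
  w i = toℚ ∣ B i ∩ R ∣
  x : ℚ
  x = a * toℚ ∣ R ∣
  1<x : 1ℚ <ℚ x
  1<x = scaled-above-one ∣ R ∣ a (ℕP.≤-trans (s≤s z≤n) 2≤r) r⁻¹<a
  wl≡r : w l ≡ toℚ ∣ R ∣
  wl≡r = cong toℚ (trans (cong (λ s → ∣ s ∩ R ∣) Bl≡⊤) (cong ∣_∣ (∩-identityˡ R)))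
  2x≤wl : x ℚ.+ x ≤ℚ w l
  2x≤wl = subst (x ℚ.+ x ≤ℚ_) (sym wl≡r) (scaled-twice-≤ ∣ R ∣ a a≤½)
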